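{- Let $k,n$ be integers with $3\leq k\leq n$, and let $G$ be a graph of order $n$. Then $0\leq \mu_k(G)\leq n-k$.
   Context: For a graph $G$ and $S\subseteq V(G)$ with $|S|\geq 2$, a pendant $S$-Steiner tree is a subgraph of $G$ that is a tree whose vertex set contains $S$ and in which every vertex of $S$ has degree exactly $1$. $\mu_G(S)$ is the maximum number of pairwise edge-disjoint pendant $S$-Steiner trees in $G$, and for $2\leq k\leq |V(G)|$, $\mu_k(G)=\min\{\mu_G(S): S\subseteq V(G),|S|=k\}$. -}

module Defs where

open import Data.Nat using (ℕ; zero; suc; _+_; _≤_)
open import Data.Bool using (Bool; true; false; if_then_else_)
open import Data.Fin using (Fin; zero; suc; inject₁; fromℕ)
open import Data.Fin.Subset using (Subset; _∈_; ∣_∣)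
open import Data.List using (List; map; allFin)
open import Data.Nat.ListAction using (sum)
open import Data.Product using (Σ; _×_)
open import Relation.Binary.PropositionalEquality using (_≡_; _≢_)
open import Function.Definitions using (Injective)
open import Relation.Nullary using (¬_)

record Graph (n : ℕ) : Set where
  field
    adj     : Fin n → Fin n → Bool
    symm    : ∀ u v → adj u v ≡ adj v u
    irrefl  : ∀ v → adj v v ≡ false
open Graph public

data Reach {n : ℕ} (es : Fin n → Fin n → Bool) : Fin n → Fin n → Set where
  here : ∀ {u} → Reach es u u
  step : ∀ {u w v} → es u w ≡ true → Reach es w v → Reach es u v

HasCycle : {n : ℕ} → (Fin n → Fin n → Bool) → Set
HasCycle {n} es =
  Σ ℕ λ l → Σ (Fin (3 + l) → Fin n) λ c →
    Injective _≡_ _≡_ c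
    × (∀ (i : Fin (2 + l)) → es (c (inject₁ i)) (c (suc i)) ≡ true)
    × (es (c (fromℕ (2 + l))) (c zero) ≡ true)

deg : {n : ℕ} → (Fin n → Fin n → Bool) → Fin n → ℕ
deg {n} es v = sum (map (λ u → if es v u then 1 else 0) (allFin n))

record Tree {n : ℕ} (G : Graph n) : Set where
  field
    vs      : Subset n
    es      : Fin n → Fin n → Bool
    es-symm : ∀ u v → es u v ≡ es v u
    es-sub  : ∀ u v → es u v ≡ true → adj G u v ≡ true
    es-vs   : ∀ u v → es u v ≡ true → u ∈ vs
    connected : ∀ u v → u ∈ vs → v ∈ vs → Reach es u v
    acyclic   : ¬ HasCycle es
open Tree public

record PendantSteinerTree {n : ℕ} (G : Graph n) (S : Subset n) : Set where
  field
    tree      : Tree G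
    contains  : ∀ v → v ∈ S → v ∈ vs tree
    pendant   : ∀ v → v ∈ S → deg (es tree) v ≡ 1
open PendantSteinerTree public

EdgeDisjoint : {n : ℕ} {G : Graph n} → Tree G → Tree G → Set
EdgeDisjoint T₁ T₂ = ∀ u v → es T₁ u v ≡ true → es T₂ u v ≡ false

DisjointFamily : {n : ℕ} (G : Graph n) (S : Subset n) (m : ℕ) → Set
DisjointFamily G S m =
  Σ (Fin m → PendantSteinerTree G S) λ T →
    ∀ i j → i ≢ j → EdgeDisjoint (tree (T i)) (tree (T j))

IsMuS : {n : ℕ} (G : Graph n) (S : Subset n) (m : ℕ) → Set
IsMuS G S m = DisjointFamily G S m × (∀ m′ → DisjointFamily G S m′ → m′ ≤ m)

IsMuK : {n : ℕ} (G : Graph n) (k : ℕ) (m : ℕ) → Set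
IsMuK {n} G k m =
  (Σ (Subset n) λ S → ∣ S ∣ ≡ k × IsMuS G S m)
  × (∀ (S : Subset n) → ∣ S ∣ ≡ k → ∀ m′ → IsMuS G S m′ → m ≤ m′)

-- Fix s ∈ S. In each of the m edge-disjoint pendant trees, s has exactly one
-- neighbour, and these neighbours are pairwise distinct because the trees share
-- no edge. A neighbour t cannot lie in S: otherwise s and t would both have
-- degree 1, so the edge st would be a whole component of the tree, leaving no
-- room for a third vertex of S. Hence the m neighbours are distinct vertices
-- outside S, and m ≤ n − |S|.
module Submission where

open import Defs
open import Data.Bool using (Bool; true; false; if_then_else_)
open import Data.Empty using (⊥-elim)
open import Data.Fin using (Fin; zero; suc; punchIn; punchOut; _≟_)
open import Data.Fin.Properties
  using (any?; injective⇒≤; punchOut-injective; punchIn-injective; punchInᵢ≢i)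
open import Data.Fin.Subset
  using (Subset; _∈_; _∉_; ∣_∣; ∁; _-_; Nonempty; inside; outside)
open import Data.Fin.Subset.Properties
  using (drop-there; ∣p∣≤∣x∷p∣; p─⊥≡p; p─q⊆p; x∉p⇒x∈∁p; ∣∁p∣≡n∸∣p∣)
open import Data.List as List using (List; map; allFin)
open import Data.List.Membership.Propositional using () renaming (_∈_ to _∈ˡ_)
open import Data.List.Membership.Propositional.Properties using (∈-allFin)
import Data.List.Relation.Unary.Any as Any
open import Data.Nat using (ℕ; zero; suc; _∸_; _≤_; _<_; z≤n; s≤s)
open import Data.Nat.ListAction using (sum)
open import Data.Nat.Properties using (≤-refl; ≤-trans; n≤1+n; m≤n+m; +-cancelˡ-≤)
open import Data.Product using (_×_; _,_; ∃; proj₁; proj₂)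
open import Data.Sum using (_⊎_; inj₁; inj₂; [_,_])
open import Data.Vec using ([]; _∷_; here; there)
open import Function.Base using (_∘_)
open import Function.Definitions using (Injective)
open import Relation.Binary.PropositionalEquality
  using (_≡_; _≢_; refl; sym; trans; subst)
open import Relation.Nullary using (Dec; yes; no; contradiction)

private
  variable
    n m : ℕ

∣x∷p∣≤1+∣p∣ : ∀ x (p : Subset n) → ∣ x ∷ p ∣ ≤ suc ∣ p ∣
∣x∷p∣≤1+∣p∣ inside  p = ≤-refl
∣x∷p∣≤1+∣p∣ outside p = n≤1+n ∣ p ∣

∣p∣≤1+∣p-x∣ : ∀ (p : Subset n) x → ∣ p ∣ ≤ suc ∣ p - x ∣
∣p∣≤1+∣p-x∣ (s ∷ p) zero =
  subst (λ q → ∣ s ∷ p ∣ ≤ suc ∣ q ∣) (sym (p─⊥≡p p)) (∣x∷p∣≤1+∣p∣ s p)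
∣p∣≤1+∣p-x∣ (inside  ∷ p) (suc x) = s≤s (∣p∣≤1+∣p-x∣ p x)
∣p∣≤1+∣p-x∣ (outside ∷ p) (suc x) = ∣p∣≤1+∣p-x∣ p x

x∉p-x : ∀ {p : Subset n} {x} → x ∉ p - x
x∉p-x {p = _ ∷ p} {suc x} (there x∈p-x) = x∉p-x {p = p} x∈p-x

0<∣p∣⇒Nonempty : ∀ (p : Subset n) → 0 < ∣ p ∣ → Nonempty p
0<∣p∣⇒Nonempty (inside  ∷ p) _ = zero , here
0<∣p∣⇒Nonempty (outside ∷ p) 0<∣p∣ with x , x∈p ← 0<∣p∣⇒Nonempty p 0<∣p∣ =
  suc x , there x∈p

∈-punchOut₀ : ∀ {s} {p : Subset n} {x} (0≢x : zero ≢ x) → x ∈ s ∷ p → punchOut 0≢x ∈ p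
∈-punchOut₀ {x = zero}  0≢0 _     = ⊥-elim (0≢0 refl)
∈-punchOut₀ {x = suc x} _   x∈s∷p = drop-there x∈s∷p

injective∈⇒≤∣p∣ : ∀ (p : Subset n) {f : Fin m → Fin n} →
                  Injective _≡_ _≡_ f → (∀ i → f i ∈ p) → m ≤ ∣ p ∣
injective∈⇒≤∣p∣ {m = zero} _ _ _ = z≤n
injective∈⇒≤∣p∣ []      f-inj _ = injective⇒≤ f-inj
injective∈⇒≤∣p∣ {m = suc m} (s ∷ p) {f} f-inj f∈ = by-cases (any? (λ i → f i ≟ zero))
  where
  -- Elements of p are counted by shifting f down past vertex zero with punchOut;
  -- an index i hitting zero is first removed with punchIn.
  avoiding-zero : ∀ {l} {g : Fin l → Fin _} → Injective _≡_ _≡_ g → (∀ j → g j ∈ s ∷ p) →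
                  (∀ j → g j ≢ zero) → l ≤ ∣ p ∣
  avoiding-zero g-inj g∈ g≢0 = injective∈⇒≤∣p∣ p
    {f = λ j → punchOut (g≢0 j ∘ sym)}
    (λ e → g-inj (punchOut-injective {i = zero} _ _ e))
    (λ j → ∈-punchOut₀ _ (g∈ j))
  at-zero : ∀ i → f i ≡ zero → zero ∈ s ∷ p → suc m ≤ ∣ s ∷ p ∣
  at-zero i fi≡0 here = s≤s (avoiding-zero
    (λ e → punchIn-injective i _ _ (f-inj e))
    (λ j → f∈ (punchIn i j))
    (λ j e → punchInᵢ≢i i j (f-inj (trans e (sym fi≡0)))))
  by-cases : Dec (∃ λ i → f i ≡ zero) → suc m ≤ ∣ s ∷ p ∣
  by-cases (no ∄i[fi≡0]) =
    ≤-trans (avoiding-zero f-inj f∈ (λ i fi≡0 → ∄i[fi≡0] (i , fi≡0))) (∣p∣≤∣x∷p∣ s p)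
  by-cases (yes (i , fi≡0)) = at-zero i fi≡0 (subst (_∈ s ∷ p) fi≡0 (f∈ i))

∈-avoiding₂ : ∀ (p : Subset n) → 3 ≤ ∣ p ∣ → ∀ x y → ∃ λ z → z ∈ p × z ≢ x × z ≢ y
∈-avoiding₂ p 3≤∣p∣ x y = avoiding (0<∣p∣⇒Nonempty (p - x - y) 0<∣p-x-y∣)
  where
  0<∣p-x-y∣ : 0 < ∣ p - x - y ∣
  0<∣p-x-y∣ = +-cancelˡ-≤ 2 1 _ (≤-trans 3≤∣p∣
    (≤-trans (∣p∣≤1+∣p-x∣ p x) (s≤s (∣p∣≤1+∣p-x∣ (p - x) y))))
  avoiding : Nonempty (p - x - y) → ∃ λ z → z ∈ p × z ≢ x × z ≢ y
  avoiding (z , z∈p-x-y) =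
    z , p─q⊆p p _ (p─q⊆p (p - x) _ z∈p-x-y)
      , (λ { refl → x∉p-x {p = p} (p─q⊆p (p - x) _ z∈p-x-y) })
      , (λ { refl → x∉p-x {p = p - x} z∈p-x-y })

module _ {A : Set} (h : A → Bool) where

  indicatorSum : List A → ℕ
  indicatorSum xs = sum (map (λ x → if h x then 1 else 0) xs)

  1≤indicatorSum : ∀ {x xs} → x ∈ˡ xs → h x ≡ true → 1 ≤ indicatorSum xs
  1≤indicatorSum (Any.here refl) hx≡true rewrite hx≡true = s≤s z≤n
  1≤indicatorSum {xs = y List.∷ _} (Any.there x∈xs) hx≡true =
    ≤-trans (1≤indicatorSum x∈xs hx≡true) (m≤n+m _ (if h y then 1 else 0))

  2≤indicatorSum : ∀ {x y xs} → x ≢ y → x ∈ˡ xs → y ∈ˡ xs → h x ≡ true → h y ≡ true →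
                   2 ≤ indicatorSum xs
  2≤indicatorSum x≢y (Any.here refl) (Any.here refl) _ _ = ⊥-elim (x≢y refl)
  2≤indicatorSum x≢y (Any.here refl) (Any.there y∈xs) hx≡true hy≡true rewrite hx≡true =
    s≤s (1≤indicatorSum y∈xs hy≡true)
  2≤indicatorSum x≢y (Any.there x∈xs) (Any.here refl) hx≡true hy≡true rewrite hy≡true =
    s≤s (1≤indicatorSum x∈xs hx≡true)
  2≤indicatorSum {xs = z List.∷ _} x≢y (Any.there x∈xs) (Any.there y∈xs) hx≡true hy≡true =
    ≤-trans (2≤indicatorSum x≢y x∈xs y∈xs hx≡true hy≡true) (m≤n+m _ (if h z then 1 else 0))

  indicatorSum≡1⇒∃ : ∀ xs → indicatorSum xs ≡ 1 → ∃ λ x → h x ≡ true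
  indicatorSum≡1⇒∃ (x List.∷ xs) sum≡1 with h x in hx≡b
  ... | true  = x , hx≡b
  ... | false = indicatorSum≡1⇒∃ xs sum≡1

module _ (es : Fin n → Fin n → Bool) {v : Fin n} (deg≡1 : deg es v ≡ 1) where

  deg≡1⇒∃neighbour : ∃ λ u → es v u ≡ true
  deg≡1⇒∃neighbour = indicatorSum≡1⇒∃ (es v) (allFin n) deg≡1

  deg≡1⇒neighbour-unique : ∀ {u w} → es v u ≡ true → es v w ≡ true → u ≡ w
  deg≡1⇒neighbour-unique {u} {w} vu vw with u ≟ w
  ... | yes u≡w = u≡w
  ... | no  u≢w with 2≤deg ← 2≤indicatorSum (es v) u≢w (∈-allFin u) (∈-allFin w) vu vw
    rewrite deg≡1 with s≤s () ← 2≤deg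

module _ {es : Fin n → Fin n → Bool} (es-symm : ∀ u v → es u v ≡ es v u)
         {s t : Fin n} (st : es s t ≡ true) (deg[s]≡1 : deg es s ≡ 1) (deg[t]≡1 : deg es t ≡ 1)
         where

  pendantEdge-Reach-closed : ∀ {u w} → Reach es u w → u ≡ s ⊎ u ≡ t → w ≡ s ⊎ w ≡ t
  pendantEdge-Reach-closed here           u∈st        = u∈st
  pendantEdge-Reach-closed (step su u′↝w) (inj₁ refl) =
    pendantEdge-Reach-closed u′↝w (inj₂ (deg≡1⇒neighbour-unique es deg[s]≡1 su st))
  pendantEdge-Reach-closed (step tu u′↝w) (inj₂ refl) =
    pendantEdge-Reach-closed u′↝w
      (inj₁ (deg≡1⇒neighbour-unique es deg[t]≡1 tu (trans (es-symm t s) st)))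

module _ {G : Graph n} {S : Subset n} (T : PendantSteinerTree G S) {s : Fin n} (s∈S : s ∈ S)
         where

  neighbour : Fin n
  neighbour = proj₁ (deg≡1⇒∃neighbour (es (tree T)) (pendant T s s∈S))

  neighbour-edge : es (tree T) s neighbour ≡ true
  neighbour-edge = proj₂ (deg≡1⇒∃neighbour (es (tree T)) (pendant T s s∈S))

  neighbour∉S : 3 ≤ ∣ S ∣ → neighbour ∉ S
  neighbour∉S 3≤∣S∣ t∈S with w , w∈S , w≢s , w≢t ← ∈-avoiding₂ S 3≤∣S∣ s neighbour =
    [ w≢s , w≢t ] (pendantEdge-Reach-closed (es-symm (tree T)) neighbour-edge
                    (pendant T s s∈S) (pendant T neighbour t∈S)
                    (connected (tree T) s w (contains T s s∈S) (contains T w w∈S)) (inj₁ refl))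

module _ {G : Graph n} {S : Subset n} (F : DisjointFamily G S m) {s : Fin n} (s∈S : s ∈ S)
         where

  neighbours : Fin m → Fin n
  neighbours i = neighbour (proj₁ F i) s∈S

  neighbours-injective : Injective _≡_ _≡_ neighbours
  neighbours-injective {i} {j} nᵢ≡nⱼ with i ≟ j
  ... | yes i≡j = i≡j
  ... | no  i≢j = contradiction
    (trans (sym (proj₂ F i j i≢j s (neighbours i) (neighbour-edge (proj₁ F i) s∈S)))
           (subst (λ u → es (tree (proj₁ F j)) s u ≡ true) (sym nᵢ≡nⱼ)
                  (neighbour-edge (proj₁ F j) s∈S)))
    (λ ())

disjointFamily-size : ∀ {G : Graph n} {S : Subset n} → 3 ≤ ∣ S ∣ → DisjointFamily G S m →
                      m ≤ n ∸ ∣ S ∣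
disjointFamily-size {S = S} 3≤∣S∣ F
  with s , s∈S ← 0<∣p∣⇒Nonempty S (≤-trans (s≤s z≤n) 3≤∣S∣) =
  subst (_ ≤_) (∣∁p∣≡n∸∣p∣ S)
    (injective∈⇒≤∣p∣ (∁ S) (neighbours-injective F s∈S)
      (λ i → x∉p⇒x∈∁p (neighbour∉S (proj₁ F i) s∈S 3≤∣S∣)))

proposition2p3 : (k n : ℕ) → 3 ≤ k → k ≤ n → (G : Graph n) →
    (m : ℕ) → IsMuK G k m → 0 ≤ m × m ≤ n ∸ k
proposition2p3 k n 3≤k _ G m ((S , ∣S∣≡k , F , _) , _) =
  z≤n , subst (λ j → m ≤ n ∸ j) ∣S∣≡k (disjointFamily-size (subst (3 ≤_) (sym ∣S∣≡k) 3≤k) F)
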